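{- Let $G$ be a finite Abelian group with identity $e$, and let $A=\{a_1,\dots,a_t\}$ be a set of generators of $G$ satisfying the triangular relations $a_1^{k_1}=e$ and $a_i^{k_i}=a_1^{\lambda_{i,1}}\cdots a_{i-1}^{\lambda_{i,i-1}}$ for $i=2,\dots,t$, where the $\lambda_{i,j}$ are nonnegative integers and, for every $i\in[t]$, $k_i\ge 2$ is the smallest positive integer such that $a_i^{k_i}\in\langle a_1,\dots,a_{i-1}\rangle$ (with $\langle\emptyset\rangle=\{e\}$). Then $G$ is isomorphic to $\Gamma(K,L)$, where $K=(k_i)$ and $L=(\lambda_{i,j})$, via the isomorphism $\Psi(x_1^{j_1}\cdots x_t^{j_t})=a_1^{j_1}\cdots a_t^{j_t}$ for all $0\le j_i\le k_i-1$, $i\in[t]$.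
   Context: For integers $\kappa_1,\dots,\kappa_t\ge 2$ and nonnegative integers $\ell_{i,j}$ ($2\le i\le t$, $1\le j<i$), $\Gamma(K,L)$ with $K=(\kappa_i)$, $L=(\ell_{i,j})$ is the set of monomials $x_1^{j_1}\cdots x_t^{j_t}$ in commuting variables with $0\le j_i\le\kappa_i-1$, viewed as elements of the quotient ring $\mathbb{R}[x_1,\dots,x_t]/I$, where $I$ is generated by $x_1^{\kappa_1}-1$ and $x_i^{\kappa_i}-x_1^{\ell_{i,1}}\cdots x_{i-1}^{\ell_{i,i-1}}$ ($i=2,\dots,t$); the product is the ring product reduced to this normal form using these relations. It is a group under this product. -}

module Defs where

open import Level using (Level; _⊔_)
open import Data.Nat using (ℕ; zero; suc; _+_; _*_; _≤_; _<_; _<?_; NonZero; >-nonZero; s≤s; z≤n)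
open import Data.Nat.DivMod using (_/_; _%_; m%n<n)
open import Data.Nat.Properties using (≤-trans)
open import Data.Fin using (Fin; toℕ; fromℕ<; _≟_)
open import Data.List using (List; foldr; allFin)
open import Data.Product using (Σ; _×_; ∃)
open import Relation.Nullary using (yes; no)
open import Algebra.Bundles using (AbelianGroup)

module _ {c ℓ} (G : AbelianGroup c ℓ) where
  open AbelianGroup G

  pow : Carrier → ℕ → Carrier
  pow x zero    = ε
  pow x (suc n) = x ∙ pow x n

  data ⟨_⟩ {s} (S : Carrier → Set s) : Carrier → Set (c ⊔ ℓ ⊔ s) where
    gen  : ∀ {x} → S x → ⟨ S ⟩ x
    unit : ⟨ S ⟩ ε
    mul  : ∀ {x y} → ⟨ S ⟩ x → ⟨ S ⟩ y → ⟨ S ⟩ (x ∙ y)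
    inv  : ∀ {x} → ⟨ S ⟩ x → ⟨ S ⟩ (x ⁻¹)
    resp : ∀ {x y} → x ≈ y → ⟨ S ⟩ x → ⟨ S ⟩ y

  IsFinite : Set (c ⊔ ℓ)
  IsFinite = Σ ℕ λ n → Σ (Fin n → Carrier) λ f → ∀ g → ∃ λ i → f i ≈ g

  Below : ∀ {t} → (Fin t → Carrier) → Fin t → Carrier → Set ℓ
  Below a i g = ∃ λ j → toℕ j < toℕ i × g ≈ a j

  AllOf : ∀ {t} → (Fin t → Carrier) → Carrier → Set ℓ
  AllOf a g = ∃ λ j → g ≈ a j

  monomial : ∀ {t} → (Fin t → Carrier) → (Fin t → ℕ) → Carrier
  monomial {t} a e = foldr (λ j r → pow (a j) (e j) ∙ r) ε (allFin t)

-- Γ(K,L): elements are exponent vectors (j_i) with 0 ≤ j_i < κ_i,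
-- standing for x_1^{j_1} ⋯ x_t^{j_t}.  L i j is ℓ_{i,j}, used only for
-- toℕ j < toℕ i.  Product = add exponents, then reduce to normal form
-- with x_1^{κ_1} = 1 and x_i^{κ_i} = x_1^{ℓ_{i,1}} ⋯ x_{i-1}^{ℓ_{i,i-1}},
-- processing indices from t down to 1.

Γ : ∀ {t} → (Fin t → ℕ) → Set
Γ {t} K = (i : Fin t) → Fin (K i)

module _ {t : ℕ} (K : Fin t → ℕ) (L : Fin t → Fin t → ℕ)
         (K≥2 : ∀ i → 2 ≤ K i) where

  private
    nz : ∀ i → NonZero (K i)
    nz i = >-nonZero (≤-trans (s≤s z≤n) (K≥2 i))

  -- one reduction step at index i: write e_i = q κ_i + r, replace
  -- x_i^{e_i} by x_i^r (x_1^{ℓ_{i,1}} ⋯ x_{i-1}^{ℓ_{i,i-1}})^q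
  reduceAt : Fin t → (Fin t → ℕ) → (Fin t → ℕ)
  reduceAt i e j with toℕ j <? toℕ i
  ... | yes _ = e j + (_/_ (e i) (K i) {{nz i}}) * L i j
  ... | no _ with j ≟ i
  ...   | yes _ = _%_ (e i) (K i) {{nz i}}
  ...   | no _  = e j

  normalise : (Fin t → ℕ) → (Fin t → ℕ)
  normalise e = foldr reduceAt e (allFin t)

  Γ-mul : Γ K → Γ K → Γ K
  Γ-mul u v i =
    fromℕ< (m%n<n (normalise (λ j → toℕ (u j) + toℕ (v j)) i) (K i) {{nz i}})

belowOnly : ∀ {t} → Fin t → (Fin t → ℕ) → Fin t → ℕ
belowOnly i f j with toℕ j <? toℕ i
... | yes _ = f j
... | no _  = 0

{-# OPTIONS --safe #-}
module Submission where

-- Multiplication in Γ(K,L) only rewrites x_i^{κ_i} as x_1^{λ_{i,1}} ⋯ x_{i-1}^{λ_{i,i-1}}, an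
-- identity that holds for the a_i in G, so Ψ is a homomorphism. The final reduction modulo κ_i
-- is harmless: the reduction at i precedes those at smaller indices, which do not touch the
-- i-th exponent.
--
-- If Ψ u = Ψ v and u, v agree at all indices above i, cancelling the common factor leaves
-- b a_i^{u_i} = b' a_i^{v_i} with b, b' ∈ ⟨a_j : j < i⟩, so a_i^{|u_i - v_i|} ∈ ⟨a_j : j < i⟩,
-- and minimality of k_i forces u_i = v_i; downward induction on i gives injectivity.
--
-- The image of Ψ is a submonoid containing every a_i, and each a_i has finite order
-- (by induction on i, since a_i^{k_i} is a product of earlier generators), so the image is
-- closed under inverses and hence is all of ⟨A⟩ = G.

open import Defs
open import Level using (_⊔_)
open import Data.Nat using (ℕ; zero; suc; _+_; _*_; _∸_; _≤_; _<_; _<?_; s≤s; z≤n; NonZero; >-nonZero; pred)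
open import Data.Nat.Properties
  using (+-identityʳ; *-comm; *-zeroʳ; ≤-refl; ≤-trans; <⇒≤; ≤-<-trans; <-≤-trans; m∸n≤m; m<n⇒0<n∸m; m+[n∸m]≡n; suc-pred)
  renaming (<-cmp to ℕ-<-cmp)
open import Data.Nat.DivMod using (_/_; _%_; m%n<n; m<n⇒m%n≡m; m≡m%n+[m/n]*n)
open import Data.Fin as Fin using (Fin; toℕ; _≟_; fromℕ<)
open import Data.Fin.Properties using (toℕ-injective; toℕ-fromℕ<; toℕ<n; <-cmp; <⇒≢; <-asym; <-irrefl)
open import Data.Fin.Induction using (<-wellFounded; >-wellFounded)
open import Data.List using (List; []; _∷_; foldr; allFin)
open import Data.List.Relation.Unary.All as All using (All; []; _∷_)
open import Data.List.Relation.Unary.Any using (here; there)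
open import Data.List.Relation.Unary.AllPairs using (AllPairs; []; _∷_)
open import Data.List.Relation.Unary.AllPairs.Properties using (tabulate⁺-<)
open import Data.List.Relation.Unary.Unique.Propositional using (Unique)
open import Data.List.Relation.Unary.Unique.Propositional.Properties using (allFin⁺)
open import Data.List.Membership.Propositional using (_∈_)
open import Data.List.Membership.Propositional.Properties using (∈-allFin)
open import Data.Product using (_×_; ∃; _,_)
open import Data.Empty using (⊥; ⊥-elim)
open import Function using (_∘_)
open import Induction.WellFounded using (Acc; acc)
open import Relation.Binary.Definitions using (tri<; tri≈; tri>)
open import Relation.Binary.PropositionalEquality as ≡ using (_≡_; _≢_; _≗_)
open import Relation.Nullary using (¬_; yes; no)
open import Algebra.Bundles using (AbelianGroup)

module AbelianGroupLemmas {c ℓ} (G : AbelianGroup c ℓ) where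
  open AbelianGroup G
  open import Algebra.Properties.AbelianGroup G using (∙-cancelʳ; y≈x\\z; inverseʳ-unique)
  open import Algebra.Properties.CommutativeMonoid.Mult commutativeMonoid
    renaming (_×_ to _times_) using (×-congʳ; ×-homo-+; ×-assocˡ; ×-distrib-+)
  open import Relation.Binary.Reasoning.Setoid setoid

  pow≡× : ∀ x n → pow G x n ≡ n times x
  pow≡× x zero    = ≡.refl
  pow≡× x (suc n) = ≡.cong (x ∙_) (pow≡× x n)

  pow-congˡ : ∀ {x y} n → x ≈ y → pow G x n ≈ pow G y n
  pow-congˡ {x} {y} n x≈y rewrite pow≡× x n | pow≡× y n = ×-congʳ n x≈y

  pow-congʳ : ∀ x {m n} → m ≡ n → pow G x m ≈ pow G x n
  pow-congʳ x m≡n = reflexive (≡.cong (pow G x) m≡n)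

  pow-+ : ∀ x m n → pow G x (m + n) ≈ pow G x m ∙ pow G x n
  pow-+ x m n rewrite pow≡× x (m + n) | pow≡× x m | pow≡× x n = ×-homo-+ x m n

  pow-* : ∀ x m n → pow G x (m * n) ≈ pow G (pow G x n) m
  pow-* x m n rewrite pow≡× x (m * n) | pow≡× x n | pow≡× (n times x) m = sym (×-assocˡ x m n)

  pow-distrib-∙ : ∀ x y n → pow G (x ∙ y) n ≈ pow G x n ∙ pow G y n
  pow-distrib-∙ x y n rewrite pow≡× (x ∙ y) n | pow≡× x n | pow≡× y n = ×-distrib-+ x y n

  pow-ε : ∀ n → pow G ε n ≈ ε
  pow-ε zero    = refl
  pow-ε (suc n) = trans (identityˡ _) (pow-ε n)

  pow-multiple-ε : ∀ x m {n} → pow G x n ≈ ε → pow G x (m * n) ≈ ε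
  pow-multiple-ε x m {n} xⁿ≈ε = trans (pow-* x m n) (trans (pow-congˡ m xⁿ≈ε) (pow-ε m))

  HasFiniteOrder : Carrier → Set ℓ
  HasFiniteOrder x = ∃ λ n → pow G x (suc n) ≈ ε

  record IsSubmonoid {p} (P : Carrier → Set p) : Set (c ⊔ ℓ ⊔ p) where
    field
      ε∈    : P ε
      ∙∈    : ∀ {x y} → P x → P y → P (x ∙ y)
      resp≈ : ∀ {x y} → x ≈ y → P x → P y

    pow∈ : ∀ {x} n → P x → P (pow G x n)
    pow∈ zero    _  = ε∈
    pow∈ (suc n) x∈ = ∙∈ x∈ (pow∈ n x∈)

    ⁻¹∈ : ∀ {x} → P x → HasFiniteOrder x → P (x ⁻¹)
    ⁻¹∈ {x} x∈ (n , xⁿ⁺¹≈ε) = resp≈ (inverseʳ-unique x (pow G x n) xⁿ⁺¹≈ε) (pow∈ n x∈)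

  ⟨⟩-isSubmonoid : ∀ {s} (S : Carrier → Set s) → IsSubmonoid (⟨_⟩ G S)
  ⟨⟩-isSubmonoid S = record { ε∈ = unit ; ∙∈ = mul ; resp≈ = resp }

  hasFiniteOrder-isSubmonoid : IsSubmonoid HasFiniteOrder
  hasFiniteOrder-isSubmonoid = record
    { ε∈    = 0 , identityʳ ε
    ; ∙∈    = ∙-finiteOrder
    ; resp≈ = λ { x≈y (n , xⁿ≈ε) → n , trans (pow-congˡ (suc n) (sym x≈y)) xⁿ≈ε }
    }
    where
    ∙-finiteOrder : ∀ {x y} → HasFiniteOrder x → HasFiniteOrder y → HasFiniteOrder (x ∙ y)
    ∙-finiteOrder {x} {y} (m , xᵐ≈ε) (n , yⁿ≈ε) = n + m * suc n , (begin
      pow G (x ∙ y) (suc m * suc n)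
        ≈⟨ pow-distrib-∙ x y (suc m * suc n) ⟩
      pow G x (suc m * suc n) ∙ pow G y (suc m * suc n)
        ≈⟨ ∙-congʳ (pow-congʳ x (*-comm (suc m) (suc n))) ⟩
      pow G x (suc n * suc m) ∙ pow G y (suc m * suc n)
        ≈⟨ ∙-cong (pow-multiple-ε x (suc n) {suc m} xᵐ≈ε) (pow-multiple-ε y (suc m) {suc n} yⁿ≈ε) ⟩
      ε ∙ ε
        ≈⟨ identityˡ ε ⟩
      ε ∎)

  hasFiniteOrder-root : ∀ x m → HasFiniteOrder (pow G x (suc m)) → HasFiniteOrder x
  hasFiniteOrder-root x m (n , [xᵐ⁺¹]ⁿ⁺¹≈ε) =
    m + n * suc m , trans (pow-* x (suc n) (suc m)) [xᵐ⁺¹]ⁿ⁺¹≈ε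

  ⟨⟩⊆torsionSubmonoid : ∀ {s p} {S : Carrier → Set s} {P : Carrier → Set p} →
    IsSubmonoid P → (∀ {x} → S x → P x) → (∀ {x} → P x → HasFiniteOrder x) →
    ∀ {x} → ⟨_⟩ G S x → P x
  ⟨⟩⊆torsionSubmonoid {S = S} {P} P-sub S⊆P torsion = go
    where
    open IsSubmonoid P-sub
    go : ∀ {x} → ⟨_⟩ G S x → P x
    go (gen x∈S)     = S⊆P x∈S
    go unit          = ε∈
    go (mul x∈ y∈)   = ∙∈ (go x∈) (go y∈)
    go (inv x∈)      = ⁻¹∈ (go x∈) (torsion (go x∈))
    go (resp x≈y x∈) = resp≈ x≈y (go x∈)

  module _ {s} {S : Carrier → Set s} {a : Carrier} {k : ℕ}
           (minimal : ∀ d → 1 ≤ d → d < k → ¬ ⟨_⟩ G S (pow G a d)) where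

    pow-offset∈⟨⟩ : ∀ {x y} m d → ⟨_⟩ G S x → ⟨_⟩ G S y →
                    x ∙ pow G a m ≈ y ∙ pow G a (m + d) → ⟨_⟩ G S (pow G a d)
    pow-offset∈⟨⟩ {x} {y} m d x∈ y∈ eq =
      resp (sym (y≈x\\z y (pow G a d) x y∙aᵈ≈x)) (mul (inv y∈) x∈)
      where
      y∙aᵈ≈x : y ∙ pow G a d ≈ x
      y∙aᵈ≈x = ∙-cancelʳ (pow G a m) _ _ (begin
        (y ∙ pow G a d) ∙ pow G a m   ≈⟨ assoc y _ _ ⟩
        y ∙ (pow G a d ∙ pow G a m)   ≈⟨ ∙-congˡ (comm _ _) ⟩
        y ∙ (pow G a m ∙ pow G a d)   ≈⟨ ∙-congˡ (pow-+ a m d) ⟨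
        y ∙ pow G a (m + d)           ≈⟨ eq ⟨
        x ∙ pow G a m                 ∎)

    no-smaller-exponent : ∀ {x y m n} → ⟨_⟩ G S x → ⟨_⟩ G S y →
                          x ∙ pow G a m ≈ y ∙ pow G a n → m < n → n < k → ⊥
    no-smaller-exponent {m = m} {n} x∈ y∈ eq m<n n<k =
      minimal (n ∸ m) (m<n⇒0<n∸m m<n) (≤-<-trans (m∸n≤m n m) n<k)
        (pow-offset∈⟨⟩ m (n ∸ m) x∈ y∈ (trans eq (∙-congˡ (pow-congʳ a n≡m+[n∸m]))))
      where
      n≡m+[n∸m] : n ≡ m + (n ∸ m)
      n≡m+[n∸m] = ≡.sym (m+[n∸m]≡n (<⇒≤ m<n))

    pow-exponent-unique : ∀ {x y m n} → ⟨_⟩ G S x → ⟨_⟩ G S y →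
                          x ∙ pow G a m ≈ y ∙ pow G a n → m < k → n < k → m ≡ n
    pow-exponent-unique {m = m} {n} x∈ y∈ eq m<k n<k with ℕ-<-cmp m n
    ... | tri< m<n _ _ = ⊥-elim (no-smaller-exponent x∈ y∈ eq m<n n<k)
    ... | tri≈ _ m≡n _ = m≡n
    ... | tri> _ _ n<m = ⊥-elim (no-smaller-exponent y∈ x∈ (sym eq) n<m m<k)

module Exponents {t : ℕ} where

  single : Fin t → ℕ → Fin t → ℕ
  single i n j with j ≟ i
  ... | yes _ = n
  ... | no  _ = 0

  single-≤ : ∀ i n j → single i n j ≤ n
  single-≤ i n j with j ≟ i
  ... | yes _ = ≤-refl
  ... | no  _ = z≤n

  single-≡ : ∀ i n → single i n i ≡ n
  single-≡ i n with i ≟ i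
  ... | yes _   = ≡.refl
  ... | no  i≢i = ⊥-elim (i≢i ≡.refl)

  single-≢ : ∀ {i j : Fin t} n → j ≢ i → single i n j ≡ 0
  single-≢ {i} {j} n j≢i with j ≟ i
  ... | yes j≡i = ⊥-elim (j≢i j≡i)
  ... | no  _   = ≡.refl

  belowOnly-< : ∀ {i j : Fin t} (f : Fin t → ℕ) → j Fin.< i → belowOnly i f j ≡ f j
  belowOnly-< {i} {j} f j<i with toℕ j <? toℕ i
  ... | yes _   = ≡.refl
  ... | no  j≮i = ⊥-elim (j≮i j<i)

  belowOnly-≮ : ∀ {i j : Fin t} (f : Fin t → ℕ) → ¬ j Fin.< i → belowOnly i f j ≡ 0
  belowOnly-≮ {i} {j} f j≮i with toℕ j <? toℕ i
  ... | yes j<i = ⊥-elim (j≮i j<i)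
  ... | no  _   = ≡.refl

  above : Fin t → (Fin t → ℕ) → Fin t → ℕ
  above i e j with toℕ i <? toℕ j
  ... | yes _ = e j
  ... | no  _ = 0

  above-< : ∀ {i j : Fin t} (e : Fin t → ℕ) → i Fin.< j → above i e j ≡ e j
  above-< {i} {j} e i<j with toℕ i <? toℕ j
  ... | yes _   = ≡.refl
  ... | no  i≮j = ⊥-elim (i≮j i<j)

  above-≮ : ∀ {i j : Fin t} (e : Fin t → ℕ) → ¬ i Fin.< j → above i e j ≡ 0
  above-≮ {i} {j} e i≮j with toℕ i <? toℕ j
  ... | yes i<j = ⊥-elim (i≮j i<j)
  ... | no  _   = ≡.refl

  above-cong : ∀ i {e f} → (∀ j → i Fin.< j → e j ≡ f j) → above i e ≗ above i f
  above-cong i e≡f j with toℕ i <? toℕ j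
  ... | yes i<j = e≡f j i<j
  ... | no  _   = ≡.refl

  -- Written as the sum of its three parts so that its monomial splits by monomialOver-+.
  setExponent : Fin t → ℕ → (Fin t → ℕ) → Fin t → ℕ
  setExponent i n e j = belowOnly i e j + (single i n j + above i e j)

  setExponent-< : ∀ {i j : Fin t} n (e : Fin t → ℕ) → j Fin.< i → setExponent i n e j ≡ e j
  setExponent-< {i} {j} n e j<i = ≡.trans
    (≡.cong₂ _+_ (belowOnly-< e j<i)
                 (≡.cong₂ _+_ (single-≢ n (<⇒≢ j<i)) (above-≮ e (<-asym j<i))))
    (+-identityʳ (e j))

  setExponent-≡ : ∀ i n e → setExponent i n e i ≡ n
  setExponent-≡ i n e = ≡.trans
    (≡.cong₂ _+_ (belowOnly-≮ {i} {i} e (<-irrefl ≡.refl))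
                 (≡.cong₂ _+_ (single-≡ i n) (above-≮ {i} {i} e (<-irrefl ≡.refl))))
    (+-identityʳ n)

  setExponent-> : ∀ {i j : Fin t} n (e : Fin t → ℕ) → i Fin.< j → setExponent i n e j ≡ e j
  setExponent-> {i} {j} n e i<j =
    ≡.cong₂ _+_ (belowOnly-≮ e (<-asym i<j))
                (≡.cong₂ _+_ (single-≢ n (≡.≢-sym (<⇒≢ i<j))) (above-< e i<j))

  setExponent-self : ∀ i e → e ≗ setExponent i (e i) e
  setExponent-self i e j with <-cmp j i
  ... | tri< j<i _ _    = ≡.sym (setExponent-< (e i) e j<i)
  ... | tri≈ _ ≡.refl _ = ≡.sym (setExponent-≡ i (e i) e)
  ... | tri> _ _ i<j    = ≡.sym (setExponent-> (e i) e i<j)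

module Monomials {c ℓ} (G : AbelianGroup c ℓ) {t : ℕ} (a : Fin t → AbelianGroup.Carrier G) where
  open AbelianGroup G
  open AbelianGroupLemmas G
  open Exponents
  open import Algebra.Properties.CommutativeSemigroup commutativeSemigroup
    using (interchange; xy∙z≈xz∙y)
  open import Relation.Binary.Reasoning.Setoid setoid

  -- monomial G a is definitionally monomialOver (allFin t).
  monomialOver : List (Fin t) → (Fin t → ℕ) → Carrier
  monomialOver xs e = foldr (λ j r → pow G (a j) (e j) ∙ r) ε xs

  monomialOver-cong : ∀ xs {e f} → e ≗ f → monomialOver xs e ≈ monomialOver xs f
  monomialOver-cong []       e≗f = refl
  monomialOver-cong (x ∷ xs) e≗f = ∙-cong (pow-congʳ (a x) (e≗f x)) (monomialOver-cong xs e≗f)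

  monomialOver-zero : ∀ {xs e} → All (λ j → e j ≡ 0) xs → monomialOver xs e ≈ ε
  monomialOver-zero []           = refl
  monomialOver-zero (eₓ≡0 ∷ e≡0) =
    trans (∙-cong (pow-congʳ _ eₓ≡0) (monomialOver-zero e≡0)) (identityˡ ε)

  monomialOver-+ : ∀ xs e f →
    monomialOver xs (λ j → e j + f j) ≈ monomialOver xs e ∙ monomialOver xs f
  monomialOver-+ []       e f = sym (identityˡ ε)
  monomialOver-+ (x ∷ xs) e f =
    trans (∙-cong (pow-+ (a x) (e x) (f x)) (monomialOver-+ xs e f)) (interchange _ _ _ _)

  monomialOver-* : ∀ xs n e → monomialOver xs (λ j → n * e j) ≈ pow G (monomialOver xs e) n
  monomialOver-* xs zero    e = monomialOver-zero (All.universal (λ _ → ≡.refl) xs)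
  monomialOver-* xs (suc n) e =
    trans (monomialOver-+ xs e (λ j → n * e j)) (∙-congˡ (monomialOver-* xs n e))

  monomialOver-single : ∀ {xs i} n → Unique xs → i ∈ xs →
                        monomialOver xs (single i n) ≈ pow G (a i) n
  monomialOver-single {x ∷ xs} n (x∉xs ∷ _) (here ≡.refl) = trans
    (∙-cong (pow-congʳ (a x) (single-≡ x n))
            (monomialOver-zero (All.map (single-≢ n ∘ ≡.≢-sym) x∉xs)))
    (identityʳ _)
  monomialOver-single {x ∷ xs} n (x∉xs ∷ xs-unique) (there i∈xs) = trans
    (∙-cong (pow-congʳ (a x) (single-≢ n (All.lookup x∉xs i∈xs)))
            (monomialOver-single n xs-unique i∈xs))
    (identityˡ _)

  monomialOver∈ : ∀ {p} {P : Carrier → Set p} → IsSubmonoid P →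
    ∀ xs e → (∀ j → P (pow G (a j) (e j))) → P (monomialOver xs e)
  monomialOver∈ P-sub []       e P-factors = IsSubmonoid.ε∈ P-sub
  monomialOver∈ P-sub (x ∷ xs) e P-factors =
    IsSubmonoid.∙∈ P-sub (P-factors x) (monomialOver∈ P-sub xs e P-factors)

  monomial-single : ∀ i n → monomial G a (single i n) ≈ pow G (a i) n
  monomial-single i n = monomialOver-single n (allFin⁺ t) (∈-allFin i)

  monomial-setExponent : ∀ i n e → monomial G a (setExponent i n e) ≈
    monomial G a (belowOnly i e) ∙ (pow G (a i) n ∙ monomial G a (above i e))
  monomial-setExponent i n e =
    trans (monomialOver-+ (allFin t) (belowOnly i e) _)
          (∙-congˡ (trans (monomialOver-+ (allFin t) (single i n) (above i e))
                          (∙-congʳ (monomial-single i n))))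

  monomial-split : ∀ i e → monomial G a e ≈
    (monomial G a (belowOnly i e) ∙ pow G (a i) (e i)) ∙ monomial G a (above i e)
  monomial-split i e = trans (monomialOver-cong (allFin t) (setExponent-self i e))
                             (trans (monomial-setExponent i (e i) e) (sym (assoc _ _ _)))

  monomial-setExponent-+ : ∀ i m n e →
    monomial G a (setExponent i m e) ∙ pow G (a i) n ≈ monomial G a (setExponent i (m + n) e)
  monomial-setExponent-+ i m n e = begin
    monomial G a (setExponent i m e) ∙ aⁿ       ≈⟨ ∙-congʳ (monomial-setExponent i m e) ⟩
    (B ∙ (pow G (a i) m ∙ A)) ∙ aⁿ              ≈⟨ assoc B _ aⁿ ⟩
    B ∙ ((pow G (a i) m ∙ A) ∙ aⁿ)              ≈⟨ ∙-congˡ (xy∙z≈xz∙y _ A aⁿ) ⟩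
    B ∙ ((pow G (a i) m ∙ aⁿ) ∙ A)              ≈⟨ ∙-congˡ (∙-congʳ (pow-+ (a i) m n)) ⟨
    B ∙ (pow G (a i) (m + n) ∙ A)               ≈⟨ monomial-setExponent i (m + n) e ⟨
    monomial G a (setExponent i (m + n) e)      ∎
    where
    aⁿ = pow G (a i) n
    B  = monomial G a (belowOnly i e)
    A  = monomial G a (above i e)

module Reduction {t : ℕ} (K : Fin t → ℕ) (L : Fin t → Fin t → ℕ) (K≥2 : ∀ i → 2 ≤ K i) where
  open Exponents

  instance
    K-nonZero : ∀ {i} → NonZero (K i)
    K-nonZero {i} = >-nonZero (≤-trans (s≤s z≤n) (K≥2 i))

  reduceAt-< : ∀ {i j} e → j Fin.< i → reduceAt K L K≥2 i e j ≡ e j + (e i / K i) * L i j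
  reduceAt-< {i} {j} e j<i with toℕ j <? toℕ i
  ... | yes _   = ≡.refl
  ... | no  j≮i = ⊥-elim (j≮i j<i)

  reduceAt-≡ : ∀ i e → reduceAt K L K≥2 i e i ≡ e i % K i
  reduceAt-≡ i e with toℕ i <? toℕ i
  ... | yes i<i = ⊥-elim (<-irrefl ≡.refl i<i)
  ... | no  _ with i ≟ i
  ...   | yes _   = ≡.refl
  ...   | no  i≢i = ⊥-elim (i≢i ≡.refl)

  reduceAt-> : ∀ {i j} e → i Fin.< j → reduceAt K L K≥2 i e j ≡ e j
  reduceAt-> {i} {j} e i<j with toℕ j <? toℕ i
  ... | yes j<i = ⊥-elim (<-asym i<j j<i)
  ... | no  _ with j ≟ i
  ...   | yes ≡.refl = ⊥-elim (<-irrefl ≡.refl i<j)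
  ...   | no  _      = ≡.refl

  private
    no-carry : ∀ {i j} q → ¬ j Fin.< i → q * belowOnly i (L i) j ≡ 0
    no-carry q j≮i = ≡.trans (≡.cong (q *_) (belowOnly-≮ _ j≮i)) (*-zeroʳ q)

  reduceAt-setExponent : ∀ i e → reduceAt K L K≥2 i e ≗
    λ j → setExponent i (e i % K i) e j + (e i / K i) * belowOnly i (L i) j
  reduceAt-setExponent i e j with <-cmp j i
  ... | tri< j<i _ _ = ≡.trans (reduceAt-< e j<i)
    (≡.cong₂ _+_ (≡.sym (setExponent-< _ e j<i))
                 (≡.cong (e i / K i *_) (≡.sym (belowOnly-< (L i) j<i))))
  ... | tri≈ _ ≡.refl j≮i = ≡.trans (reduceAt-≡ i e)
    (≡.sym (≡.trans (≡.cong₂ _+_ (setExponent-≡ i _ e) (no-carry (e i / K i) j≮i)) (+-identityʳ _)))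
  ... | tri> j≮i _ i<j = ≡.trans (reduceAt-> e i<j)
    (≡.sym (≡.trans (≡.cong₂ _+_ (setExponent-> _ e i<j) (no-carry (e i / K i) j≮i)) (+-identityʳ _)))

  reduceAll-< : ∀ {xs} e {i} → AllPairs Fin._<_ xs → i ∈ xs →
                foldr (reduceAt K L K≥2) e xs i < K i
  reduceAll-< {x ∷ xs} e _ (here ≡.refl) =
    ≡.subst (_< K x) (≡.sym (reduceAt-≡ x _)) (m%n<n _ (K x))
  reduceAll-< {x ∷ xs} e {i} (x<xs ∷ xs-sorted) (there i∈xs) =
    ≡.subst (_< K i) (≡.sym (reduceAt-> _ (All.lookup x<xs i∈xs))) (reduceAll-< e xs-sorted i∈xs)

  normalise-< : ∀ e i → normalise K L K≥2 e i < K i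
  normalise-< e i = reduceAll-< e (tabulate⁺-< (λ i<j → i<j)) (∈-allFin i)

module Presentation {c ℓ} (G : AbelianGroup c ℓ) {t : ℕ} (a : Fin t → AbelianGroup.Carrier G)
  (k : Fin t → ℕ) (Λ : Fin t → Fin t → ℕ) (k≥2 : ∀ i → 2 ≤ k i)
  (relation : ∀ i → AbelianGroup._≈_ G (pow G (a i) (k i)) (monomial G a (belowOnly i (Λ i))))
  where

  open AbelianGroup G
  open AbelianGroupLemmas G
  open IsSubmonoid
  open Exponents
  open Monomials G a
  open Reduction k Λ k≥2
  open import Algebra.Properties.AbelianGroup G using (∙-cancelʳ)
  open import Relation.Binary.Reasoning.Setoid setoid

  Ψ : Γ k → Carrier
  Ψ u = monomial G a (λ i → toℕ (u i))

  monomial-reduceAt : ∀ i e → monomial G a (reduceAt k Λ k≥2 i e) ≈ monomial G a e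
  monomial-reduceAt i e = begin
    monomial G a (reduceAt k Λ k≥2 i e)
      ≈⟨ monomialOver-cong (allFin t) (reduceAt-setExponent i e) ⟩
    monomial G a (λ j → setExponent i r e j + q * b j)
      ≈⟨ monomialOver-+ (allFin t) (setExponent i r e) (λ j → q * b j) ⟩
    monomial G a (setExponent i r e) ∙ monomial G a (λ j → q * b j)
      ≈⟨ ∙-congˡ (monomialOver-* (allFin t) q b) ⟩
    monomial G a (setExponent i r e) ∙ pow G (monomial G a b) q
      ≈⟨ ∙-congˡ (pow-congˡ q (relation i)) ⟨
    monomial G a (setExponent i r e) ∙ pow G (pow G (a i) (k i)) q
      ≈⟨ ∙-congˡ (pow-* (a i) q (k i)) ⟨
    monomial G a (setExponent i r e) ∙ pow G (a i) (q * k i)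
      ≈⟨ monomial-setExponent-+ i r (q * k i) e ⟩
    monomial G a (setExponent i (r + q * k i) e)
      ≈⟨ monomialOver-cong (allFin t) (λ j → ≡.cong (λ n → setExponent i n e j) eᵢ≡r+qk) ⟨
    monomial G a (setExponent i (e i) e)
      ≈⟨ monomialOver-cong (allFin t) (setExponent-self i e) ⟨
    monomial G a e ∎
    where
    r = e i % k i
    q = e i / k i
    b = belowOnly i (Λ i)
    eᵢ≡r+qk : e i ≡ r + q * k i
    eᵢ≡r+qk = m≡m%n+[m/n]*n (e i) (k i)

  monomial-reduceAll : ∀ xs e → monomial G a (foldr (reduceAt k Λ k≥2) e xs) ≈ monomial G a e
  monomial-reduceAll []       e = refl
  monomial-reduceAll (x ∷ xs) e = trans (monomial-reduceAt x _) (monomial-reduceAll xs e)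

  Ψ-homomorphic : ∀ u v → Ψ (Γ-mul k Λ k≥2 u v) ≈ Ψ u ∙ Ψ v
  Ψ-homomorphic u v = begin
    Ψ (Γ-mul k Λ k≥2 u v)
      ≈⟨ monomialOver-cong (allFin t) (λ i → ≡.trans (toℕ-fromℕ< _) (m<n⇒m%n≡m (normalise-< e i))) ⟩
    monomial G a (normalise k Λ k≥2 e)
      ≈⟨ monomial-reduceAll (allFin t) e ⟩
    monomial G a e
      ≈⟨ monomialOver-+ (allFin t) (toℕ ∘ u) (toℕ ∘ v) ⟩
    Ψ u ∙ Ψ v ∎
    where
    e = λ j → toℕ (u j) + toℕ (v j)

  belowOnly∈⟨Below⟩ : ∀ i e → ⟨_⟩ G (Below G a i) (monomial G a (belowOnly i e))
  belowOnly∈⟨Below⟩ i e = monomialOver∈ (⟨⟩-isSubmonoid _) (allFin t) (belowOnly i e) factor∈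
    where
    factor∈ : ∀ j → ⟨_⟩ G (Below G a i) (pow G (a j) (belowOnly i e j))
    factor∈ j with toℕ j <? toℕ i
    ... | yes j<i = pow∈ (⟨⟩-isSubmonoid _) (e j) (gen (j , j<i , refl))
    ... | no  _   = unit

  module _ (minimal : ∀ i (m : ℕ) → 1 ≤ m → m < k i → ¬ ⟨_⟩ G (Below G a i) (pow G (a i) m)) where

    Ψ-agree-at : ∀ {u v} i → Ψ u ≈ Ψ v → (∀ j → i Fin.< j → u j ≡ v j) → u i ≡ v i
    Ψ-agree-at {u} {v} i Ψu≈Ψv agree-above = toℕ-injective
      (pow-exponent-unique (minimal i) (belowOnly∈⟨Below⟩ i U) (belowOnly∈⟨Below⟩ i V)
                           lower-parts≈ (toℕ<n (u i)) (toℕ<n (v i)))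
      where
      U V : Fin t → ℕ
      U = toℕ ∘ u
      V = toℕ ∘ v
      agree-above′ : ∀ j → i Fin.< j → U j ≡ V j
      agree-above′ j i<j = ≡.cong toℕ (agree-above j i<j)
      lower-parts≈ : monomial G a (belowOnly i U) ∙ pow G (a i) (U i) ≈
                     monomial G a (belowOnly i V) ∙ pow G (a i) (V i)
      lower-parts≈ = ∙-cancelʳ (monomial G a (above i V)) _ _ (begin
        (monomial G a (belowOnly i U) ∙ pow G (a i) (U i)) ∙ monomial G a (above i V)
          ≈⟨ ∙-congˡ (monomialOver-cong (allFin t) (above-cong i agree-above′)) ⟨
        (monomial G a (belowOnly i U) ∙ pow G (a i) (U i)) ∙ monomial G a (above i U)
          ≈⟨ monomial-split i U ⟨
        Ψ u
          ≈⟨ Ψu≈Ψv ⟩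
        Ψ v
          ≈⟨ monomial-split i V ⟩
        (monomial G a (belowOnly i V) ∙ pow G (a i) (V i)) ∙ monomial G a (above i V) ∎)

    Ψ-injective : ∀ u v → Ψ u ≈ Ψ v → ∀ i → u i ≡ v i
    Ψ-injective u v Ψu≈Ψv i = agree (>-wellFounded i)
      where
      agree : ∀ {i} → Acc Fin._>_ i → u i ≡ v i
      agree {i} (acc rec) = Ψ-agree-at i Ψu≈Ψv (λ j i<j → agree (rec i<j))

  generator-hasFiniteOrder : ∀ i → HasFiniteOrder (a i)
  generator-hasFiniteOrder i = go (<-wellFounded i)
    where
    go : ∀ {i} → Acc Fin._<_ i → HasFiniteOrder (a i)
    go {i} (acc rec) = hasFiniteOrder-root (a i) (pred (k i))
      (resp≈ hasFiniteOrder-isSubmonoid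
        (trans (sym (relation i)) (pow-congʳ (a i) (≡.sym (suc-pred (k i)))))
        (monomialOver∈ hasFiniteOrder-isSubmonoid (allFin t) (belowOnly i (Λ i)) factor-finite))
      where
      factor-finite : ∀ j → HasFiniteOrder (pow G (a j) (belowOnly i (Λ i) j))
      factor-finite j with toℕ j <? toℕ i
      ... | yes j<i = pow∈ hasFiniteOrder-isSubmonoid (Λ i j) (go (rec j<i))
      ... | no  _   = ε∈ hasFiniteOrder-isSubmonoid

  Ψ-hasFiniteOrder : ∀ u → HasFiniteOrder (Ψ u)
  Ψ-hasFiniteOrder u = monomialOver∈ hasFiniteOrder-isSubmonoid (allFin t) (toℕ ∘ u)
    (λ j → pow∈ hasFiniteOrder-isSubmonoid (toℕ (u j)) (generator-hasFiniteOrder j))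

  InImage : Carrier → Set ℓ
  InImage g = ∃ λ u → Ψ u ≈ g

  monomial-InImage : ∀ e → (∀ i → e i ≤ 1) → InImage (monomial G a e)
  monomial-InImage e e≤1 = (λ i → fromℕ< (<-≤-trans (s≤s (e≤1 i)) (k≥2 i))) ,
                           monomialOver-cong (allFin t) {f = e} (λ i → toℕ-fromℕ< _)

  inImage-isSubmonoid : IsSubmonoid InImage
  inImage-isSubmonoid = record
    { ε∈    = resp≈′ (monomialOver-zero (All.universal (λ _ → ≡.refl) (allFin t)))
                     (monomial-InImage (λ _ → 0) (λ _ → z≤n))
    ; ∙∈    = λ { (u , Ψu≈x) (v , Ψv≈y) →
                  Γ-mul k Λ k≥2 u v , trans (Ψ-homomorphic u v) (∙-cong Ψu≈x Ψv≈y) }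
    ; resp≈ = resp≈′
    }
    where
    resp≈′ : ∀ {x y} → x ≈ y → InImage x → InImage y
    resp≈′ x≈y (u , Ψu≈x) = u , trans Ψu≈x x≈y

  Ψ-surjective : (∀ g → ⟨_⟩ G (AllOf G a) g) → ∀ g → InImage g
  Ψ-surjective generated g =
    ⟨⟩⊆torsionSubmonoid inImage-isSubmonoid generator∈ image-torsion (generated g)
    where
    generator∈ : ∀ {x} → AllOf G a x → InImage x
    generator∈ (j , x≈aⱼ) = resp≈ inImage-isSubmonoid
      (trans (monomial-single j 1) (trans (identityʳ (a j)) (sym x≈aⱼ)))
      (monomial-InImage (single j 1) (single-≤ j 1))
    image-torsion : ∀ {x} → InImage x → HasFiniteOrder x
    image-torsion (u , Ψu≈x) = resp≈ hasFiniteOrder-isSubmonoid Ψu≈x (Ψ-hasFiniteOrder u)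

mainTheorem11 : ∀ {c ℓ} (G : AbelianGroup c ℓ) → IsFinite G →
  (t : ℕ) (a : Fin t → AbelianGroup.Carrier G) →
  (∀ g → ⟨_⟩ G (AllOf G a) g) →
  (k : Fin t → ℕ) (Λ : Fin t → Fin t → ℕ) →
  (k≥2 : ∀ i → 2 ≤ k i) →
  (∀ i → AbelianGroup._≈_ G (pow G (a i) (k i))
           (monomial G a (belowOnly i (Λ i)))) →
  (∀ i (m : ℕ) → 1 ≤ m → m < k i → ¬ ⟨_⟩ G (Below G a i) (pow G (a i) m)) →
  let Ψ : Γ k → AbelianGroup.Carrier G
      Ψ u = monomial G a (λ i → toℕ (u i))
  in (∀ u v → AbelianGroup._≈_ G (Ψ (Γ-mul k Λ k≥2 u v))
                (AbelianGroup._∙_ G (Ψ u) (Ψ v)))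
     × (∀ u v → AbelianGroup._≈_ G (Ψ u) (Ψ v) → ∀ i → u i ≡ v i)
     × (∀ g → ∃ λ u → AbelianGroup._≈_ G (Ψ u) g)
mainTheorem11 G _ t a generated k Λ k≥2 relation minimal =
  Ψ-homomorphic , Ψ-injective minimal , Ψ-surjective generated
  where open Presentation G a k Λ k≥2 relation
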